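{- Let $U$ be a point set with a hidden clustering, and let $A,B\subseteq U$ be independent sets. There is a deterministic non-adaptive algorithm $\mathsf{IS}$-$\mathsf{MATCH}$ which reconstructs the bipartite matching $M(A,B)$ using $O\!\left(|A|\cdot\frac{\log|B|}{\log|A|}\right)$ subset queries.
   Context: $U$ has a hidden partition $U=C_1\sqcup\cdots\sqcup C_k$; a subset query on $S\subseteq U$ returns $\mathsf{count}(S)=|\{i: C_i\cap S\neq\emptyset\}|$. A set $A\subseteq U$ is an independent set if its elements belong to pairwise distinct clusters. For independent sets $A,B$, $M(A,B)$ is the bipartite graph on $A$ and $B$ with an edge between $x\in A$ and $y\in B$ iff $x$ and $y$ belong to the same cluster (it is a matching). Non-adaptive means all queries are fixed before any answer is seen. -}

module Defs where

open import Data.Nat using (ℕ; _≟_)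
open import Data.Fin using (Fin)
open import Data.Fin.Subset using (Subset; _∈_)
open import Data.Fin.Subset.Properties using (_∈?_)
open import Data.List using (List; length; filter; map; deduplicate; allFin)
open import Relation.Binary.PropositionalEquality using (_≡_)

-- The ground set U is Fin n.  A hidden clustering is a labelling
-- cl : Fin n → ℕ ; the clusters C_i are the nonempty fibres of cl.
Clustering : ℕ → Set
Clustering n = Fin n → ℕ

elems : ∀ {n} → Subset n → List (Fin n)
elems {n} S = filter (_∈? S) (allFin n)

-- count(S) = number of clusters meeting S = number of distinct labels on S
count : ∀ {n} → Clustering n → Subset n → ℕ
count cl S = length (deduplicate _≟_ (map cl (elems S)))

Independent : ∀ {n} → Clustering n → Subset n → Set
Independent cl A = ∀ x y → x ∈ A → y ∈ A → cl x ≡ cl y → x ≡ y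

MatchEdge : ∀ {n} → Clustering n → Fin n → Fin n → Set
MatchEdge cl x y = cl x ≡ cl y

-- Write π(a) for the partner in B of a ∈ A, if it has one. For a pan P ⊆ A and a set T ⊆ B the
-- answer to the query P ∪ T is |P| + |T| minus the number of a ∈ P with π(a) ∈ T, so it is the
-- weight of P under the 0/1 coin assignment a ↦ [π(a) ∈ T]. Lindström's detecting design
-- determines any such assignment on m coins from the weights of O(m / log m) pans, and π is
-- determined by the assignments for T = B and for ⌈log₂ |B|⌉ sets separating the points of B.
-- This makes O(|A| log |B| / log |A|) queries; the decoder searches exhaustively for a candidate
-- matching consistent with all answers, and every consistent candidate agrees with π on A.

module Submission where

open import Defs
open import Data.Bool using (Bool; true; false; if_then_else_)
open import Data.Empty using (⊥-elim)
open import Data.Fin using (Fin; zero; suc; splitAt; _↑ˡ_; _↑ʳ_; finToFun; funToFin)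
open import Data.Fin.Properties using (splitAt-↑ˡ; splitAt-↑ʳ; finToFun-funToFin)
import Data.Fin.Properties as Fin
open import Data.Fin.Subset using (Subset; _∈_; ∣_∣)
import Data.Fin.Subset.Properties as Subset
import Data.List as List
open import Data.List
  using (List; []; _∷_; _++_; length; filter; take; drop; deduplicate; allFin; tabulate; lookup; cartesianProduct)
open import Data.List.Properties
  using (take++drop≡id; length-take; length-drop; length-map; length-++; length-tabulate; map-++)
open import Data.List.Membership.Propositional using (lose; find) renaming (_∈_ to _∈ₗ_)
open import Data.List.Membership.Propositional.Properties
  using (∈-++⁻; ∈-++⁺ˡ; ∈-++⁺ʳ; ∈-filter⁻; ∈-filter⁺; ∈-map⁺; ∈-map⁻; ∈-allFin; ∈-tabulate⁺; ∈-tabulate⁻;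
         ∈-lookup;         ∈-cartesianProduct⁺; ∈-cartesianProduct⁻; deduplicate-∈⇔)
open import Data.List.Membership.Propositional.Properties.WithK using (unique∧set⇒bag)
open import Data.List.Relation.Binary.BagAndSetEquality using (∼bag⇒↭; map-cong)
open import Data.List.Relation.Binary.Disjoint.Propositional using (Disjoint)
open import Data.List.Relation.Binary.Permutation.Propositional.Properties using (↭-length)
open import Data.List.Relation.Binary.Sublist.Propositional using (_⊆_; []; _∷_; _∷ʳ_; minimum; ⊆-refl)
open import Data.List.Relation.Binary.Sublist.Propositional.Properties
  using (++⁺; ++⁺ʳ; take-⊆; drop-⊆; All-resp-⊆; Any-resp-⊆) renaming (map⁺ to ⊆-map⁺)
open import Data.List.Relation.Unary.All as All using (All)
open import Data.List.Relation.Unary.All.Properties using () renaming (map⁺ to All-map⁺)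
open import Data.List.Relation.Unary.Any as Any using (here; there; any?)
open import Data.List.Relation.Unary.Any.Properties using (lookup-index)
open import Data.List.Relation.Unary.AllPairs using ([]; _∷_)
open import Data.List.Relation.Unary.Unique.Propositional using (Unique)
open import Data.List.Relation.Unary.Unique.Propositional.Properties using ()
  renaming (map⁺ to Unique-map⁺; ++⁺ to Unique-++⁺; filter⁺ to Unique-filter⁺;
            take⁺ to Unique-take⁺; drop⁺ to Unique-drop⁺)
open import Data.List.Relation.Unary.Unique.DecPropositional.Properties using (deduplicate-!)
open import Data.Nat using (ℕ; zero; suc; _+_; _*_; _∸_; _^_; _≤_; _<_; z≤n; s≤s; _≤?_; ⌈_/2⌉; ⌊_/2⌋)
open import Data.Nat.Properties
open import Algebra.Properties.CommutativeSemigroup +-commutativeSemigroup using (xy∙z≈xz∙y)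
open import Data.Nat.Logarithm using (⌊log₂_⌋; ⌈log₂_⌉; ⌊log₂⌋-mono-≤; ⌈log₂⌉-mono-≤; ⌊log₂[2^n]⌋≡n)
open import Data.Nat.Logarithm.Core using (⌈log2⌉)
open import Data.Nat.Tactic.RingSolver using (solve)
open import Data.Product using (Σ; ∃-syntax; _×_; _,_; proj₁; proj₂)
open import Data.Sum using (_⊎_; inj₁; inj₂; [_,_]′)
open import Data.Vec using (Vec; map; here; there)
import Data.Vec as Vec
open import Data.Vec.Properties using (lookup∘tabulate; lookup-map; []=⇒lookup; lookup⇒[]=)
open import Function using (_∘_; _∘′_)
open import Function.Bundles using (_⇔_; mk⇔; Equivalence)
import Function.Properties.Equivalence as ⇔
open import Induction.WellFounded using (Acc; acc)
open import Relation.Binary.Definitions using (DecidableEquality)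
open import Relation.Binary.PropositionalEquality
  using (_≡_; _≗_; refl; sym; trans; cong; cong₂; subst; module ≡-Reasoning)
open import Relation.Nullary using (¬_; Dec; yes; no; does; ¬?)
open import Relation.Nullary.Decidable using (dec-true; dec-false; does-⇔)
open import Relation.Unary using (Decidable)

private
  variable
    X Y : Set
    n : ℕ

weight : (X → Bool) → List X → ℕ
weight f [] = 0
weight f (x ∷ xs) = (if f x then 1 else 0) + weight f xs

weight-++ : (f : X → Bool) (xs ys : List X) → weight f (xs ++ ys) ≡ weight f xs + weight f ys
weight-++ f [] ys = refl
weight-++ f (x ∷ xs) ys =
  trans (cong (_ +_) (weight-++ f xs ys)) (sym (+-assoc (if f x then 1 else 0) _ _))

weight-map : (f : Y → Bool) (g : X → Y) (xs : List X) → weight f (List.map g xs) ≡ weight (f ∘ g) xs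
weight-map f g [] = refl
weight-map f g (x ∷ xs) = cong (_ +_) (weight-map f g xs)

weight-cong : {f g : X → Bool} → f ≗ g → (xs : List X) → weight f xs ≡ weight g xs
weight-cong f≗g [] = refl
weight-cong f≗g (x ∷ xs) = cong₂ (λ b w → (if b then 1 else 0) + w) (f≗g x) (weight-cong f≗g xs)

weight-[x]-injective : (f g : X → Bool) {x : X} → weight f (x ∷ []) ≡ weight g (x ∷ []) → f x ≡ g x
weight-[x]-injective f g {x} eq with f x | g x
... | true  | true  = refl
... | false | false = refl
... | true  | false = ⊥-elim (1+n≢0 eq)
... | false | true  = ⊥-elim (1+n≢0 (sym eq))

length-cartesianProduct : (xs : List X) (ys : List Y) → length (cartesianProduct xs ys) ≡ length xs * length ys
length-cartesianProduct [] ys = refl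
length-cartesianProduct (x ∷ xs) ys =
  trans (length-++ (List.map (x ,_) ys)) (cong₂ _+_ (length-map (x ,_) ys) (length-cartesianProduct xs ys))

length-filter-∁+weight : {P : X → Set} (P? : Decidable P) (xs : List X) →
  length (filter (¬? ∘ P?) xs) + weight (does ∘ P?) xs ≡ length xs
length-filter-∁+weight P? [] = refl
length-filter-∁+weight P? (x ∷ xs) with P? x
... | yes _ = trans (+-suc _ _) (cong suc (length-filter-∁+weight P? xs))
... | no _ = cong suc (length-filter-∁+weight P? xs)

does≡true⇔ : {A : Set} (a? : Dec A) → does a? ≡ true ⇔ A
does≡true⇔ (yes a) = mk⇔ (λ _ → a) (λ _ → refl)
does≡true⇔ (no ¬a) = mk⇔ (λ ()) (λ a → ⊥-elim (¬a a))

does-≡⇒⇔ : {A B : Set} (a? : Dec A) (b? : Dec B) → does a? ≡ does b? → A ⇔ B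
does-≡⇒⇔ a? b? eq =
  ⇔.trans (⇔.sym (does≡true⇔ a?))
    (⇔.trans (subst (λ b → does a? ≡ true ⇔ b ≡ true) eq ⇔.refl) (does≡true⇔ b?))

Unique-resp-⊇ : {xs ys : List X} → xs ⊆ ys → Unique ys → Unique xs
Unique-resp-⊇ [] _ = []
Unique-resp-⊇ (y ∷ʳ τ) (_ ∷ u) = Unique-resp-⊇ τ u
Unique-resp-⊇ (refl ∷ τ) (y∉ ∷ u) = All-resp-⊆ τ y∉ ∷ Unique-resp-⊇ τ u

Unique-map-injectiveOn : (f : X → Y) {xs : List X} → (∀ {a b} → a ∈ₗ xs → b ∈ₗ xs → f a ≡ f b → a ≡ b) →
  Unique xs → Unique (List.map f xs)
Unique-map-injectiveOn f inj [] = []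
Unique-map-injectiveOn f inj (x∉ ∷ u) =
  All-map⁺ (All.tabulate (λ b∈ fx≡fb → All.lookup x∉ b∈ (inj (here refl) (there b∈) fx≡fb)))
  ∷ Unique-map-injectiveOn f (λ a∈ b∈ → inj (there a∈) (there b∈)) u

take-drop-disjoint : ∀ k {xs : List X} → Unique xs → Disjoint (take k xs) (drop k xs)
take-drop-disjoint (suc k) {x ∷ xs} (x∉ ∷ _) (here refl , q) = All.lookup x∉ (Any-resp-⊆ (drop-⊆ k xs) q) refl
take-drop-disjoint (suc k) {x ∷ xs} (_ ∷ u) (there p , q) = take-drop-disjoint k u (p , q)

∈-take⊎drop : ∀ k {xs : List X} {x} → x ∈ₗ xs → x ∈ₗ take k xs ⊎ x ∈ₗ drop k xs
∈-take⊎drop k {xs} {x} x∈ = ∈-++⁻ (take k xs) (subst (x ∈ₗ_) (sym (take++drop≡id k xs)) x∈)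

length-take≤ : ∀ k (xs : List X) → length (take k xs) ≤ k
length-take≤ k xs = ≤-trans (≤-reflexive (length-take k xs)) (m⊓n≤m _ _)

length-drop≤ : ∀ k (xs : List X) → length xs ≤ 2 * k → length (drop k xs) ≤ k
length-drop≤ k xs len = begin
  length (drop k xs) ≡⟨ length-drop k xs ⟩
  length xs ∸ k      ≤⟨ ∸-monoˡ-≤ k len ⟩
  k + (k + 0) ∸ k    ≡⟨ m+n∸m≡n k _ ⟩
  k + 0              ≡⟨ +-identityʳ k ⟩
  k                  ∎
  where open ≤-Reasoning

module _ (_≟_ : DecidableEquality X) where
  open import Data.List.Membership.DecPropositional _≟_ using (_∈?_; _∉?_)

  length-deduplicate : ∀ xs {ys} → Unique ys → (∀ {x} → x ∈ₗ xs ⇔ x ∈ₗ ys) →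
    length (deduplicate _≟_ xs) ≡ length ys
  length-deduplicate xs uys same = ↭-length (∼bag⇒↭ (unique∧set⇒bag (deduplicate-! _≟_ xs) uys
    (⇔.trans (⇔.sym (deduplicate-∈⇔ _≟_)) same)))

  ∈-filter∉-++⇔ : ∀ xs ys {x} → x ∈ₗ filter (_∉? ys) xs ++ ys ⇔ x ∈ₗ xs ++ ys
  ∈-filter∉-++⇔ xs ys {x} = mk⇔ to from
    where
    to : x ∈ₗ filter (_∉? ys) xs ++ ys → x ∈ₗ xs ++ ys
    to x∈ with ∈-++⁻ (filter (_∉? ys) xs) x∈
    ... | inj₁ x∈f = ∈-++⁺ˡ (proj₁ (∈-filter⁻ (_∉? ys) {xs = xs} x∈f))
    ... | inj₂ x∈ys = ∈-++⁺ʳ xs x∈ys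
    from : x ∈ₗ xs ++ ys → x ∈ₗ filter (_∉? ys) xs ++ ys
    from x∈ with ∈-++⁻ xs x∈ | x ∈? ys
    ... | inj₂ x∈ys | _ = ∈-++⁺ʳ _ x∈ys
    ... | inj₁ _ | yes x∈ys = ∈-++⁺ʳ _ x∈ys
    ... | inj₁ x∈xs | no x∉ys = ∈-++⁺ˡ (∈-filter⁺ (_∉? ys) x∈xs x∉ys)

  length-deduplicate-union : ∀ xs ys → Unique xs → Unique ys → ∀ zs → (∀ {x} → x ∈ₗ zs ⇔ x ∈ₗ xs ++ ys) →
    length (deduplicate _≟_ zs) + weight (λ x → does (x ∈? ys)) xs ≡ length xs + length ys
  length-deduplicate-union xs ys uxs uys zs same = begin
    length (deduplicate _≟_ zs) + w
      ≡⟨ cong (_+ w) (length-deduplicate zs uU (⇔.trans same (⇔.sym (∈-filter∉-++⇔ xs ys)))) ⟩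
    length (F ++ ys) + w      ≡⟨ cong (_+ w) (length-++ F) ⟩
    length F + length ys + w  ≡⟨ xy∙z≈xz∙y (length F) _ _ ⟩
    length F + w + length ys  ≡⟨ cong (_+ length ys) (length-filter-∁+weight (_∈? ys) xs) ⟩
    length xs + length ys     ∎
    where
    open ≡-Reasoning
    F = filter (_∉? ys) xs
    w = weight (λ x → does (x ∈? ys)) xs
    uU : Unique (F ++ ys)
    uU = Unique-++⁺ (Unique-filter⁺ (_∉? ys) uxs) uys
      (λ (x∈F , x∈ys) → proj₂ (∈-filter⁻ (_∉? ys) {xs = xs} x∈F) x∈ys)

-- Lindström's detecting design

weighings coins : ℕ → ℕ
weighings zero = 1
weighings (suc j) = weighings j + weighings j
coins zero = 1
coins (suc j) = coins j + coins j + weighings j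

record Weighing (X : Set) : Set where
  constructor _⚖_
  field
    left right : List X
open Weighing

-- f and g give the same reading weight L − weight R, stated without truncated subtraction.
SameReading : (f g : X → Bool) → Weighing X → Set
SameReading f g (L ⚖ R) = weight f L + weight g R ≡ weight g L + weight f R

slot : ∀ {k} → List X → Fin k → List X
slot [] _ = []
slot (x ∷ _) zero = x ∷ []
slot (_ ∷ xs) (suc i) = slot xs i

slot-⊆ : ∀ {k} (xs : List X) (i : Fin k) → slot xs i ⊆ xs
slot-⊆ [] _ = []
slot-⊆ (x ∷ xs) zero = refl ∷ minimum xs
slot-⊆ (x ∷ xs) (suc i) = x ∷ʳ slot-⊆ xs i

weight-slot≤1 : ∀ {k} (f : X → Bool) (xs : List X) (i : Fin k) → weight f (slot xs i) ≤ 1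
weight-slot≤1 f [] _ = z≤n
weight-slot≤1 f (x ∷ xs) zero with f x
... | true = ≤-refl
... | false = z≤n
weight-slot≤1 f (x ∷ xs) (suc i) = weight-slot≤1 f xs i

slot-cover : ∀ {k} {x : X} {xs} → x ∈ₗ xs → length xs ≤ k → ∃[ i ] slot {k = k} xs i ≡ x ∷ []
slot-cover {k = suc k} (here refl) _ = zero , refl
slot-cover {k = suc k} (there x∈) (s≤s len) = let i , eq = slot-cover x∈ len in suc i , eq

part₁ part₂ part₃ : ℕ → List X → List X
part₁ j ws = take (coins j) ws
part₂ j ws = take (coins j) (drop (coins j) ws)
part₃ j ws = drop (coins j) (drop (coins j) ws)

parts-++ : ∀ j (ws : List X) → part₁ j ws ++ part₂ j ws ++ part₃ j ws ≡ ws
parts-++ j ws = trans (cong (part₁ j ws ++_) (take++drop≡id (coins j) _)) (take++drop≡id (coins j) ws)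

∈-parts : ∀ j (ws : List X) {x} → x ∈ₗ ws → x ∈ₗ part₁ j ws ⊎ x ∈ₗ part₂ j ws ⊎ x ∈ₗ part₃ j ws
∈-parts j ws {x} x∈ with ∈-++⁻ (part₁ j ws) (subst (x ∈ₗ_) (sym (parts-++ j ws)) x∈)
... | inj₁ x∈₁ = inj₁ x∈₁
... | inj₂ x∈₂₃ = inj₂ (∈-++⁻ (part₂ j ws) x∈₂₃)

⊆-parts : ∀ j (ws : List X) {xs} → xs ⊆ part₁ j ws ++ part₂ j ws ++ part₃ j ws → xs ⊆ ws
⊆-parts j ws {xs} = subst (xs ⊆_) (parts-++ j ws)

length-part₃ : ∀ j (ws : List X) → length ws ≤ coins (suc j) → length (part₃ j ws) ≤ weighings j
length-part₃ j ws len = begin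
  length (part₃ j ws)                   ≡⟨ length-drop (coins j) _ ⟩
  length (drop (coins j) ws) ∸ coins j  ≡⟨ cong (_∸ coins j) (length-drop (coins j) ws) ⟩
  length ws ∸ coins j ∸ coins j         ≤⟨ ∸-monoˡ-≤ (coins j) (∸-monoˡ-≤ (coins j) len) ⟩
  coins j + coins j + weighings j ∸ coins j ∸ coins j
    ≡⟨ cong (λ t → t ∸ coins j ∸ coins j) (+-assoc (coins j) (coins j) (weighings j)) ⟩
  coins j + (coins j + weighings j) ∸ coins j ∸ coins j
    ≡⟨ cong (_∸ coins j) (m+n∸m≡n (coins j) _) ⟩
  coins j + weighings j ∸ coins j       ≡⟨ m+n∸m≡n (coins j) _ ⟩
  weighings j                           ∎
  where open ≤-Reasoning

-- The upper and lower weighing i of level j + 1 put weighing i of level j on the first two parts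
-- on the same resp. opposite pans, so their readings are the sum and the difference of the parts'
-- readings; the coin in the slot of the upper weighing is recovered from the parity of the sum.
design : (j : ℕ) → List X → Fin (weighings j) → Weighing X
upper lower : (j : ℕ) → List X → Fin (weighings j) → Weighing X
design zero ws _ = take 1 ws ⚖ []
design (suc j) ws i = [ upper j ws , lower j ws ]′ (splitAt (weighings j) i)
upper j ws i = (left D₁ ++ left D₂ ++ slot (part₃ j ws) i) ⚖ (right D₁ ++ right D₂)
  where D₁ = design j (part₁ j ws) i
        D₂ = design j (part₂ j ws) i
lower j ws i = (left D₁ ++ right D₂) ⚖ (right D₁ ++ left D₂)
  where D₁ = design j (part₁ j ws) i
        D₂ = design j (part₂ j ws) i

design-↑ˡ : ∀ j (ws : List X) i → design (suc j) ws (i ↑ˡ weighings j) ≡ upper j ws i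
design-↑ˡ j ws i = cong [ upper j ws , lower j ws ]′ (splitAt-↑ˡ (weighings j) i (weighings j))

design-↑ʳ : ∀ j (ws : List X) i → design (suc j) ws (weighings j ↑ʳ i) ≡ lower j ws i
design-↑ʳ j ws i = cong [ upper j ws , lower j ws ]′ (splitAt-↑ʳ (weighings j) (weighings j) i)

design-⊆ : ∀ j (ws : List X) i → left (design j ws i) ⊆ ws × right (design j ws i) ⊆ ws
design-⊆ zero ws _ = take-⊆ 1 ws , minimum ws
design-⊆ (suc j) ws i with splitAt (weighings j) i
... | inj₁ i′ =
  let L₁ , R₁ = design-⊆ j (part₁ j ws) i′
      L₂ , R₂ = design-⊆ j (part₂ j ws) i′
  in ⊆-parts j ws (++⁺ L₁ (++⁺ L₂ (slot-⊆ _ i′))) , ⊆-parts j ws (++⁺ R₁ (++⁺ʳ _ R₂))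
... | inj₂ i′ =
  let L₁ , R₁ = design-⊆ j (part₁ j ws) i′
      L₂ , R₂ = design-⊆ j (part₂ j ws) i′
  in ⊆-parts j ws (++⁺ L₁ (++⁺ʳ _ R₂)) , ⊆-parts j ws (++⁺ R₁ (++⁺ʳ _ L₂))

double+bit-injective : ∀ x y {u v} → u ≤ 1 → v ≤ 1 → x + x + u ≡ y + y + v → x ≡ y × u ≡ v
double+bit-injective zero zero _ _ eq = refl , eq
double+bit-injective zero (suc y) u≤1 _ eq =
  ⊥-elim (2≰1 (≤-trans (2≤double+ y _) (≤-trans (≤-reflexive (sym eq)) u≤1)))
  where
  2≤double+ : ∀ y v → 2 ≤ suc y + suc y + v
  2≤double+ y v = s≤s (≤-trans (s≤s z≤n) (≤-trans (m≤n+m (suc y) y) (m≤m+n _ v)))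
  2≰1 : ¬ 2 ≤ 1
  2≰1 (s≤s ())
double+bit-injective (suc x) zero u≤1 v≤1 eq =
  let y≡x , v≡u = double+bit-injective zero (suc x) v≤1 u≤1 (sym eq) in sym y≡x , sym v≡u
double+bit-injective (suc x) (suc y) {u} {v} u≤1 v≤1 eq =
  let x≡y , u≡v = double+bit-injective x y u≤1 v≤1 (suc-injective (suc-injective (begin
        suc (suc (x + x + u)) ≡⟨ cong (λ t → suc t + u) (sym (+-suc x x)) ⟩
        suc x + suc x + u     ≡⟨ eq ⟩
        suc y + suc y + v     ≡⟨ cong (λ t → suc t + v) (+-suc y y) ⟩
        suc (suc (y + y + v)) ∎)))
  in cong suc x≡y , u≡v
  where open ≡-Reasoning

-- aᵢ and bᵢ weigh the left and right pan of the weighing on part i, u the slot; primes mark g.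
lindström-arith : ∀ a₁ b₁ a₂ b₂ u a₁′ b₁′ a₂′ b₂′ u′ → u ≤ 1 → u′ ≤ 1 →
  (a₁ + (a₂ + u)) + (b₁′ + b₂′) ≡ (a₁′ + (a₂′ + u′)) + (b₁ + b₂) →
  (a₁ + b₂) + (b₁′ + a₂′) ≡ (a₁′ + b₂′) + (b₁ + a₂) →
  a₁ + b₁′ ≡ a₁′ + b₁ × a₂ + b₂′ ≡ a₂′ + b₂ × u ≡ u′
lindström-arith a₁ b₁ a₂ b₂ u a₁′ b₁′ a₂′ b₂′ u′ u≤1 u′≤1 upper lower = first , second , u≡u′
  where
  open ≡-Reasoning
  sum : (a₁ + b₁′) + (a₁ + b₁′) + u + (a₂ + b₂ + a₂′ + b₂′)
      ≡ (a₁′ + b₁) + (a₁′ + b₁) + u′ + (a₂ + b₂ + a₂′ + b₂′)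
  sum = begin
    (a₁ + b₁′) + (a₁ + b₁′) + u + (a₂ + b₂ + a₂′ + b₂′)
      ≡⟨ solve (a₁ ∷ b₁ ∷ a₂ ∷ b₂ ∷ u ∷ b₁′ ∷ a₂′ ∷ b₂′ ∷ []) ⟩
    ((a₁ + (a₂ + u)) + (b₁′ + b₂′)) + ((a₁ + b₂) + (b₁′ + a₂′))
      ≡⟨ cong₂ _+_ upper lower ⟩
    ((a₁′ + (a₂′ + u′)) + (b₁ + b₂)) + ((a₁′ + b₂′) + (b₁ + a₂))
      ≡⟨ solve (a₁′ ∷ b₁ ∷ a₂ ∷ b₂ ∷ u′ ∷ a₂′ ∷ b₂′ ∷ []) ⟩
    (a₁′ + b₁) + (a₁′ + b₁) + u′ + (a₂ + b₂ + a₂′ + b₂′) ∎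
  halves = double+bit-injective (a₁ + b₁′) (a₁′ + b₁) u≤1 u′≤1
    (+-cancelʳ-≡ (a₂ + b₂ + a₂′ + b₂′) _ _ sum)
  first = proj₁ halves
  u≡u′ = proj₂ halves
  second : a₂ + b₂′ ≡ a₂′ + b₂
  second = +-cancelˡ-≡ (a₁′ + b₁) _ _ (begin
    (a₁′ + b₁) + (a₂ + b₂′)  ≡⟨ solve (a₁′ ∷ b₁ ∷ a₂ ∷ b₂′ ∷ []) ⟩
    (a₁′ + b₂′) + (b₁ + a₂)  ≡⟨ sym lower ⟩
    (a₁ + b₂) + (b₁′ + a₂′)  ≡⟨ solve (a₁ ∷ b₂ ∷ b₁′ ∷ a₂′ ∷ []) ⟩
    (a₁ + b₁′) + (a₂′ + b₂)  ≡⟨ cong (_+ (a₂′ + b₂)) first ⟩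
    (a₁′ + b₁) + (a₂′ + b₂)  ∎)

module _ (f g : X → Bool) where

  readings-split : ∀ j (ws : List X) → (∀ i → SameReading f g (design (suc j) ws i)) → ∀ i →
    SameReading f g (design j (part₁ j ws) i) × SameReading f g (design j (part₂ j ws) i)
      × weight f (slot (part₃ j ws) i) ≡ weight g (slot (part₃ j ws) i)
  readings-split j ws same i =
    lindström-arith (weight f L₁) (weight f R₁) (weight f L₂) (weight f R₂) (weight f s)
                    (weight g L₁) (weight g R₁) (weight g L₂) (weight g R₂) (weight g s)
                    (weight-slot≤1 f (part₃ j ws) i) (weight-slot≤1 g (part₃ j ws) i)
      (trans (sym (cong₂ _+_ (weight-++³ f) (weight-++ g R₁ R₂)))
             (trans up (cong₂ _+_ (weight-++³ g) (weight-++ f R₁ R₂))))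
      (trans (sym (cong₂ _+_ (weight-++ f L₁ R₂) (weight-++ g R₁ L₂)))
             (trans low (cong₂ _+_ (weight-++ g L₁ R₂) (weight-++ f R₁ L₂))))
    where
    L₁ = left (design j (part₁ j ws) i)
    R₁ = right (design j (part₁ j ws) i)
    L₂ = left (design j (part₂ j ws) i)
    R₂ = right (design j (part₂ j ws) i)
    s = slot (part₃ j ws) i
    up = subst (SameReading f g) (design-↑ˡ j ws i) (same (i ↑ˡ weighings j))
    low = subst (SameReading f g) (design-↑ʳ j ws i) (same (weighings j ↑ʳ i))
    weight-++³ : ∀ h → weight h (L₁ ++ L₂ ++ s) ≡ weight h L₁ + (weight h L₂ + weight h s)
    weight-++³ h = trans (weight-++ h L₁ _) (cong (weight h L₁ +_) (weight-++ h L₂ s))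

  design-detects : ∀ j (ws : List X) → length ws ≤ coins j →
    (∀ i → SameReading f g (design j ws i)) → ∀ {x} → x ∈ₗ ws → f x ≡ g x
  design-detects zero (x ∷ []) _ same (here refl) = weight-[x]-injective f g (+-cancelʳ-≡ 0 _ _ (same zero))
  design-detects zero (_ ∷ []) _ _ (there ())
  design-detects zero (_ ∷ _ ∷ _) (s≤s ()) _ _
  design-detects (suc j) ws len same x∈ with ∈-parts j ws x∈
  ... | inj₁ x∈₁ =
    design-detects j _ (length-take≤ (coins j) ws) (λ i → proj₁ (readings-split j ws same i)) x∈₁
  ... | inj₂ (inj₁ x∈₂) =
    design-detects j _ (length-take≤ (coins j) _) (λ i → proj₁ (proj₂ (readings-split j ws same i))) x∈₂
  ... | inj₂ (inj₂ x∈₃) with slot-cover x∈₃ (length-part₃ j ws len)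
  ...   | i , slot≡[x] = weight-[x]-injective f g
          (subst (λ s → weight f s ≡ weight g s) slot≡[x] (proj₂ (proj₂ (readings-split j ws same i))))

-- Separating families

-- The element at position p < 2 ^ K of l lies in separator K l i iff bit i of p, counted
-- from the most significant of K bits, is 1.
separator : (K : ℕ) → List X → Fin K → List X
separator (suc K) l zero = drop (2 ^ K) l
separator (suc K) l (suc i) = separator K (take (2 ^ K) l) i ++ separator K (drop (2 ^ K) l) i

separator-⊆ : ∀ K (l : List X) i → separator K l i ⊆ l
separator-⊆ (suc K) l zero = drop-⊆ (2 ^ K) l
separator-⊆ (suc K) l (suc i) =
  subst (separator (suc K) l (suc i) ⊆_) (take++drop≡id (2 ^ K) l)
    (++⁺ (separator-⊆ K (take (2 ^ K) l) i) (separator-⊆ K (drop (2 ^ K) l) i))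

module _ (K : ℕ) {l : List X} (u : Unique l) (i : Fin K) {y : X} where

  ∈-separator-take : y ∈ₗ take (2 ^ K) l →
    y ∈ₗ separator (suc K) l (suc i) ⇔ y ∈ₗ separator K (take (2 ^ K) l) i
  ∈-separator-take y∈t = mk⇔ to ∈-++⁺ˡ
    where
    to : y ∈ₗ separator (suc K) l (suc i) → y ∈ₗ separator K (take (2 ^ K) l) i
    to y∈ with ∈-++⁻ (separator K (take (2 ^ K) l) i) y∈
    ... | inj₁ y∈′ = y∈′
    ... | inj₂ y∈′ = ⊥-elim (take-drop-disjoint (2 ^ K) u (y∈t , Any-resp-⊆ (separator-⊆ K _ i) y∈′))

  ∈-separator-drop : y ∈ₗ drop (2 ^ K) l →
    y ∈ₗ separator (suc K) l (suc i) ⇔ y ∈ₗ separator K (drop (2 ^ K) l) i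
  ∈-separator-drop y∈d = mk⇔ to (∈-++⁺ʳ _)
    where
    to : y ∈ₗ separator (suc K) l (suc i) → y ∈ₗ separator K (drop (2 ^ K) l) i
    to y∈ with ∈-++⁻ (separator K (take (2 ^ K) l) i) y∈
    ... | inj₁ y∈′ = ⊥-elim (take-drop-disjoint (2 ^ K) u (Any-resp-⊆ (separator-⊆ K _ i) y∈′ , y∈d))
    ... | inj₂ y∈′ = y∈′

separators-separate : ∀ K {l : List X} → Unique l → length l ≤ 2 ^ K → ∀ {y z} → y ∈ₗ l → z ∈ₗ l →
  (∀ i → y ∈ₗ separator K l i ⇔ z ∈ₗ separator K l i) → y ≡ z
separators-separate zero _ _ (here refl) (here refl) _ = refl
separators-separate zero {_ ∷ []} _ _ (there ()) _ _
separators-separate zero {_ ∷ []} _ _ (here refl) (there ()) _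
separators-separate zero {_ ∷ _ ∷ _} _ (s≤s ()) _ _ _
separators-separate (suc K) {l} u len {y} {z} y∈ z∈ same
  with ∈-take⊎drop (2 ^ K) y∈ | ∈-take⊎drop (2 ^ K) z∈
... | inj₁ y∈t | inj₁ z∈t =
  separators-separate K (Unique-take⁺ (2 ^ K) u) (length-take≤ (2 ^ K) l) y∈t z∈t λ i →
    ⇔.trans (⇔.sym (∈-separator-take K u i y∈t)) (⇔.trans (same (suc i)) (∈-separator-take K u i z∈t))
... | inj₂ y∈d | inj₂ z∈d =
  separators-separate K (Unique-drop⁺ (2 ^ K) u) (length-drop≤ (2 ^ K) l len) y∈d z∈d λ i →
    ⇔.trans (⇔.sym (∈-separator-drop K u i y∈d)) (⇔.trans (same (suc i)) (∈-separator-drop K u i z∈d))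
... | inj₁ y∈t | inj₂ z∈d = ⊥-elim (take-drop-disjoint (2 ^ K) u (y∈t , Equivalence.from (same zero) z∈d))
... | inj₂ y∈d | inj₁ z∈t = ⊥-elim (take-drop-disjoint (2 ^ K) u (z∈t , Equivalence.to (same zero) y∈d))

-- Counting the clusters met by a union

members : Subset n → List (Fin n)
members Vec.[] = []
members (true Vec.∷ p) = zero ∷ List.map suc (members p)
members (false Vec.∷ p) = List.map suc (members p)

length-members : (p : Subset n) → length (members p) ≡ ∣ p ∣
length-members Vec.[] = refl
length-members (true Vec.∷ p) = cong suc (trans (length-map suc (members p)) (length-members p))
length-members (false Vec.∷ p) = trans (length-map suc (members p)) (length-members p)

members-unique : (p : Subset n) → Unique (members p)
members-unique Vec.[] = []
members-unique (true Vec.∷ p) =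
  All-map⁺ (All.tabulate (λ _ ())) ∷ Unique-map⁺ Fin.suc-injective (members-unique p)
members-unique (false Vec.∷ p) = Unique-map⁺ Fin.suc-injective (members-unique p)

∈-members⇔ : (p : Subset n) {x : Fin n} → x ∈ₗ members p ⇔ x ∈ p
∈-members⇔ p = mk⇔ (to p) (from p)
  where
  to : ∀ {n} (p : Subset n) {x} → x ∈ₗ members p → x ∈ p
  to (true Vec.∷ p) (here refl) = here
  to (true Vec.∷ p) (there x∈) with ∈-map⁻ suc x∈
  ... | _ , z∈ , refl = there (to p z∈)
  to (false Vec.∷ p) x∈ with ∈-map⁻ suc x∈
  ... | _ , z∈ , refl = there (to p z∈)
  from : ∀ {n} (p : Subset n) {x} → x ∈ p → x ∈ₗ members p
  from (true Vec.∷ p) here = here refl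
  from (true Vec.∷ p) (there x∈) = there (∈-map⁺ suc (from p x∈))
  from (false Vec.∷ p) (there x∈) = ∈-map⁺ suc (from p x∈)

∈-elems⇔ : (p : Subset n) {x : Fin n} → x ∈ₗ elems p ⇔ x ∈ p
∈-elems⇔ {n} p {x} = mk⇔ (λ x∈ → proj₂ (∈-filter⁻ (Subset._∈? p) {xs = allFin n} x∈))
                         (∈-filter⁺ (Subset._∈? p) (∈-allFin x))

module _ {n : ℕ} where
  open import Data.List.Membership.DecPropositional (Fin._≟_ {n}) using (_∈?_)

  subsetOf : List (Fin n) → Subset n
  subsetOf xs = Vec.tabulate (λ x → does (x ∈? xs))

  ∈-subsetOf⇔ : ∀ xs {x} → x ∈ subsetOf xs ⇔ x ∈ₗ xs
  ∈-subsetOf⇔ xs {x} = ⇔.trans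
    (mk⇔ (λ x∈ → trans (sym (lookup∘tabulate _ x)) ([]=⇒lookup x∈))
         (λ eq → lookup⇒[]= x _ (trans (lookup∘tabulate _ x) eq)))
    (does≡true⇔ (x ∈? xs))

module _ where
  open import Data.List.Membership.DecPropositional _≟_ using (_∈?_)

  meets : Clustering n → List (Fin n) → Fin n → Bool
  meets cl T a = does (cl a ∈? List.map cl T)

  count-subsetOf-++ : (cl : Clustering n) (P T : List (Fin n)) →
    Unique (List.map cl P) → Unique (List.map cl T) →
    count cl (subsetOf (P ++ T)) + weight (meets cl T) P ≡ length P + length T
  count-subsetOf-++ cl P T uP uT = begin
    count cl S + weight (meets cl T) P
      ≡⟨ cong (count cl S +_) (sym (weight-map (λ c → does (c ∈? List.map cl T)) cl P)) ⟩
    count cl S + weight (λ c → does (c ∈? List.map cl T)) (List.map cl P)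
      ≡⟨ length-deduplicate-union _≟_ (List.map cl P) (List.map cl T) uP uT (List.map cl (elems S)) labels ⟩
    length (List.map cl P) + length (List.map cl T)
      ≡⟨ cong₂ _+_ (length-map cl P) (length-map cl T) ⟩
    length P + length T ∎
    where
    open ≡-Reasoning
    S = subsetOf (P ++ T)
    labels : ∀ {c} → c ∈ₗ List.map cl (elems S) ⇔ c ∈ₗ List.map cl P ++ List.map cl T
    labels {c} = subst (λ cs → c ∈ₗ List.map cl (elems S) ⇔ c ∈ₗ cs) (map-++ cl P T)
      (map-cong (λ _ → refl) (⇔.trans (∈-elems⇔ S) (∈-subsetOf⇔ (P ++ T))))

-- The number of queries

weighings≡2^ : ∀ j → weighings j ≡ 2 ^ j
weighings≡2^ zero = refl
weighings≡2^ (suc j) =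
  trans (cong₂ _+_ (weighings≡2^ j) (weighings≡2^ j)) (cong (2 ^ j +_) (sym (+-identityʳ _)))

2*coins : ∀ j → 2 * coins j ≡ (j + 2) * weighings j
2*coins zero = refl
2*coins (suc j) = step j (coins j) (weighings j) (2*coins j)
  where
  step : ∀ j c w → 2 * c ≡ (j + 2) * w → 2 * (c + c + w) ≡ (suc j + 2) * (w + w)
  step j c w 2c≡ = begin
    2 * (c + c + w)           ≡⟨ solve (c ∷ w ∷ []) ⟩
    2 * (2 * c) + 2 * w       ≡⟨ cong (λ t → 2 * t + 2 * w) 2c≡ ⟩
    2 * ((j + 2) * w) + 2 * w ≡⟨ solve (j ∷ w ∷ []) ⟩
    (suc j + 2) * (w + w)     ∎
    where open ≡-Reasoning

n≤2^⌈log2⌉n : ∀ n (a : Acc _<_ n) → n ≤ 2 ^ ⌈log2⌉ n a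
n≤2^⌈log2⌉n zero _ = z≤n
n≤2^⌈log2⌉n (suc zero) _ = s≤s z≤n
n≤2^⌈log2⌉n (suc (suc n)) (acc rs) = begin
  suc (suc n)                   ≡⟨ cong (suc ∘′ suc) (sym (⌊n/2⌋+⌈n/2⌉≡n n)) ⟩
  suc (suc (⌊ n /2⌋ + ⌈ n /2⌉)) ≤⟨ s≤s (s≤s (+-monoˡ-≤ ⌈ n /2⌉ (⌊n/2⌋≤⌈n/2⌉ n))) ⟩
  suc (suc (⌈ n /2⌉ + ⌈ n /2⌉)) ≡⟨ cong suc (sym (trans (cong (⌈ n /2⌉ +_) (+-identityʳ _)) (+-suc _ _))) ⟩
  2 * suc ⌈ n /2⌉               ≤⟨ *-monoʳ-≤ 2 (n≤2^⌈log2⌉n (suc ⌈ n /2⌉) _) ⟩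
  2 * 2 ^ ⌈log2⌉ (suc ⌈ n /2⌉) _ ∎
  where open ≤-Reasoning

n≤2^⌈log₂n⌉ : ∀ n → n ≤ 2 ^ ⌈log₂ n ⌉
n≤2^⌈log₂n⌉ n = n≤2^⌈log2⌉n n _

-- level m is the least j with m ≤ coins j.
level : ℕ → ℕ
level zero = zero
level (suc m) with suc m ≤? coins (level m)
... | yes _ = level m
... | no _ = suc (level m)

1≤weighings : ∀ j → 1 ≤ weighings j
1≤weighings zero = s≤s z≤n
1≤weighings (suc j) = ≤-trans (1≤weighings j) (m≤m+n _ _)

level-covers : ∀ m → m ≤ coins (level m)
level-covers zero = z≤n
level-covers (suc m) with suc m ≤? coins (level m)
... | yes m<c = m<c
... | no m≮c = begin
  suc m                        ≡⟨ +-comm 1 m ⟩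
  m + 1                        ≤⟨ +-mono-≤ (m≤m+n m m) (1≤weighings l) ⟩
  m + m + weighings l          ≡⟨ cong (λ c → c + c + weighings l) (sym c≡m) ⟩
  coins (suc l)                ∎
  where
  open ≤-Reasoning
  l = level m
  c≡m : coins l ≡ m
  c≡m = ≤-antisym (≤-pred (≰⇒> m≮c)) (level-covers m)

weighings*suc≡4*coins : ∀ l → weighings (suc l) * suc (suc l) ≡ 4 * coins l
weighings*suc≡4*coins l = begin
  weighings (suc l) * suc (suc l) ≡⟨ step l (weighings l) ⟩
  2 * ((l + 2) * weighings l)     ≡⟨ cong (2 *_) (sym (2*coins l)) ⟩
  2 * (2 * coins l)               ≡⟨ sym (*-assoc 2 2 (coins l)) ⟩
  4 * coins l                     ∎
  where
  open ≡-Reasoning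
  step : ∀ l w → (w + w) * suc (suc l) ≡ 2 * ((l + 2) * w)
  step l w = solve (l ∷ w ∷ [])

level-tight : ∀ m → weighings (level (suc m)) * suc (level (suc m)) ≤ 4 * suc m
level-tight m with suc m ≤? coins (level m)
level-tight zero    | yes _ = s≤s z≤n
level-tight (suc m) | yes _ = ≤-trans (level-tight m) (*-monoʳ-≤ 4 (n≤1+n (suc m)))
level-tight m       | no m≮c = begin
  weighings (suc l) * suc (suc l) ≡⟨ weighings*suc≡4*coins l ⟩
  4 * coins l                     ≤⟨ *-monoʳ-≤ 4 (≤-pred (≰⇒> m≮c)) ⟩
  4 * m                           ≤⟨ *-monoʳ-≤ 4 (n≤1+n m) ⟩
  4 * suc m                       ∎
  where
  open ≤-Reasoning
  l = level m

j+2≤2*weighings : ∀ j → j + 2 ≤ 2 * weighings j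
j+2≤2*weighings zero = ≤-refl
j+2≤2*weighings (suc j) = begin
  suc (j + 2)                         ≤⟨ s≤s (j+2≤2*weighings j) ⟩
  suc (2 * weighings j)               ≡⟨ +-comm 1 _ ⟩
  2 * weighings j + 1                 ≤⟨ +-monoʳ-≤ (2 * weighings j) (≤-trans (1≤weighings j) (m≤m+n _ _)) ⟩
  2 * weighings j + 2 * weighings j   ≡⟨ sym (*-distribˡ-+ 2 (weighings j) _) ⟩
  2 * (weighings j + weighings j)     ∎
  where open ≤-Reasoning

coins≤2^ : ∀ j → coins j ≤ 2 ^ (j + j)
coins≤2^ j = *-cancelˡ-≤ 2 (begin
  2 * coins j                    ≡⟨ 2*coins j ⟩
  (j + 2) * weighings j          ≤⟨ *-monoˡ-≤ (weighings j) (j+2≤2*weighings j) ⟩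
  2 * weighings j * weighings j  ≡⟨ *-assoc 2 (weighings j) _ ⟩
  2 * (weighings j * weighings j) ≡⟨ cong (2 *_) (cong₂ _*_ (weighings≡2^ j) (weighings≡2^ j)) ⟩
  2 * (2 ^ j * 2 ^ j)            ≡⟨ cong (2 *_) (sym (^-distribˡ-+-* 2 j j)) ⟩
  2 * 2 ^ (j + j)                ∎)
  where open ≤-Reasoning

⌊log₂⌋≤2*level : ∀ m → ⌊log₂ m ⌋ ≤ level m + level m
⌊log₂⌋≤2*level m = ≤-trans (⌊log₂⌋-mono-≤ (≤-trans (level-covers m) (coins≤2^ (level m))))
                           (≤-reflexive (⌊log₂[2^n]⌋≡n _))

weighings*⌊log₂⌋ : ∀ {m} → 1 ≤ m → weighings (level m) * ⌊log₂ m ⌋ ≤ 8 * m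
weighings*⌊log₂⌋ {suc m} _ = step (weighings (level (suc m))) (level (suc m)) ⌊log₂ suc m ⌋ (suc m)
  (⌊log₂⌋≤2*level (suc m)) (level-tight m)
  where
  step : ∀ w l L m → L ≤ l + l → w * suc l ≤ 4 * m → w * L ≤ 8 * m
  step w l L m L≤ w*l≤ = begin
    w * L                 ≤⟨ *-monoʳ-≤ w (≤-trans L≤ (+-mono-≤ (n≤1+n l) (n≤1+n l))) ⟩
    w * (suc l + suc l)   ≡⟨ solve (w ∷ l ∷ []) ⟩
    2 * (w * suc l)       ≤⟨ *-monoʳ-≤ 2 w*l≤ ⟩
    2 * (4 * m)           ≡⟨ sym (*-assoc 2 4 m) ⟩
    8 * m                 ∎
    where open ≤-Reasoning

query-bound : ∀ w L m K → 1 ≤ K → w * L ≤ 8 * m → (w + w) * suc K * L ≤ 32 * m * K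
query-bound w L m K 1≤K w*L≤ = begin
  (w + w) * suc K * L     ≡⟨ solve (w ∷ K ∷ L ∷ []) ⟩
  2 * suc K * (w * L)     ≤⟨ *-monoʳ-≤ (2 * suc K) w*L≤ ⟩
  2 * suc K * (8 * m)     ≡⟨ solve (K ∷ m ∷ []) ⟩
  16 * m * (1 + K)        ≤⟨ *-monoʳ-≤ (16 * m) (+-monoˡ-≤ K 1≤K) ⟩
  16 * m * (K + K)        ≡⟨ solve (m ∷ K ∷ []) ⟩
  32 * m * K              ∎
  where open ≤-Reasoning

-- Queries and decoder

Test : ℕ → Set
Test n = List (Fin n) × List (Fin n)

querySet : Test n → Subset n
querySet (P , T) = subsetOf (P ++ T)

size : Test n → ℕ
size (P , T) = length P + length T

module Scheme {n : ℕ} (A B : Subset n) where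
  open import Data.List.Membership.DecPropositional (Fin._≟_ {n}) using (_∈?_)

  j K : ℕ
  j = level ∣ A ∣
  K = ⌈log₂ ∣ B ∣ ⌉

  weighingsOfA : List (Weighing (Fin n))
  weighingsOfA = tabulate (design j (members A))

  pans family : List (List (Fin n))
  pans = List.map left weighingsOfA ++ List.map right weighingsOfA
  family = members B ∷ tabulate (separator K (members B))

  tests : List (Test n)
  tests = cartesianProduct pans family

  q : ℕ
  q = length tests

  queries : Vec (Subset n) q
  queries = Vec.tabulate (querySet ∘ lookup tests)

  -- A candidate sends each element to suc of its partner in B, or to zero if it has none.
  Candidate : Set
  Candidate = Fin n → Fin (suc n)

  pointsInto : Fin (suc n) → List (Fin n) → Bool
  pointsInto zero _ = false
  pointsInto (suc y) T = does (y ∈? T)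

  hits : Candidate → Test n → ℕ
  hits π (P , T) = weight (λ a → pointsInto (π a) T) P

  Consistent : Vec ℕ q → Candidate → Set
  Consistent answers π = ∀ i → Vec.lookup answers i + hits π (lookup tests i) ≡ size (lookup tests i)

  consistent? : ∀ answers π → Dec (Consistent answers π)
  consistent? answers π = Fin.all? (λ i → _ ≟ _)

  decode : Vec ℕ q → Fin n → Fin n → Bool
  decode answers x y with Fin.any? (λ k → consistent? answers (finToFun k))
  ... | yes (k , _) = does (finToFun k x Fin.≟ suc y)
  ... | no _ = false

  length-tests : q ≡ (weighings j + weighings j) * suc K
  length-tests = begin
    length (cartesianProduct pans family)   ≡⟨ length-cartesianProduct pans family ⟩
    length pans * length family
      ≡⟨ cong₂ _*_ length-pans (cong suc (length-tabulate (separator K (members B)))) ⟩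
    (weighings j + weighings j) * suc K     ∎
    where
    open ≡-Reasoning
    length-pans : length pans ≡ weighings j + weighings j
    length-pans = trans (length-++ (List.map left weighingsOfA))
      (cong₂ _+_ (trans (length-map left weighingsOfA) (length-tabulate (design j (members A))))
                 (trans (length-map right weighingsOfA) (length-tabulate (design j (members A)))))

  q-bound : 2 ≤ ∣ A ∣ → 2 ≤ ∣ B ∣ → q * ⌊log₂ ∣ A ∣ ⌋ ≤ 32 * ∣ A ∣ * K
  q-bound 2≤∣A∣ 2≤∣B∣ = subst (λ q → q * ⌊log₂ ∣ A ∣ ⌋ ≤ 32 * ∣ A ∣ * K) (sym length-tests)
    (query-bound (weighings j) ⌊log₂ ∣ A ∣ ⌋ ∣ A ∣ K (⌈log₂⌉-mono-≤ 2≤∣B∣)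
                 (weighings*⌊log₂⌋ (≤-trans (s≤s z≤n) 2≤∣A∣)))

  members-A-fits : length (members A) ≤ coins j
  members-A-fits = ≤-trans (≤-reflexive (length-members A)) (level-covers ∣ A ∣)

  members-B-fits : length (members B) ≤ 2 ^ K
  members-B-fits = ≤-trans (≤-reflexive (length-members B)) (n≤2^⌈log₂n⌉ ∣ B ∣)

  pan-⊆ : ∀ {P} → P ∈ₗ pans → P ⊆ members A
  pan-⊆ P∈ with ∈-++⁻ (List.map left weighingsOfA) P∈
  ... | inj₁ P∈ˡ with ∈-map⁻ left P∈ˡ
  ...   | _ , w∈ , refl with ∈-tabulate⁻ w∈
  ...     | i , refl = proj₁ (design-⊆ j (members A) i)
  pan-⊆ P∈ | inj₂ P∈ʳ with ∈-map⁻ right P∈ʳ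
  ...   | _ , w∈ , refl with ∈-tabulate⁻ w∈
  ...     | i , refl = proj₂ (design-⊆ j (members A) i)

  family-⊆ : ∀ {T} → T ∈ₗ family → T ⊆ members B
  family-⊆ (here refl) = ⊆-refl
  family-⊆ (there T∈) with ∈-tabulate⁻ T∈
  ... | i , refl = separator-⊆ K (members B) i

  Consistent-resp-≗ : ∀ {answers π π′} → π ≗ π′ → Consistent answers π → Consistent answers π′
  Consistent-resp-≗ π≗π′ c i =
    trans (cong (_ +_) (weight-cong (λ a → cong (λ y → pointsInto y T) (sym (π≗π′ a))) P)) (c i)
    where P = proj₁ (lookup tests i)
          T = proj₂ (lookup tests i)

  module _ {answers : Vec ℕ q} {π π′ : Candidate}
           (c : Consistent answers π) (c′ : Consistent answers π′) where

    hits-agree : ∀ {t} → t ∈ₗ tests → hits π t ≡ hits π′ t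
    hits-agree t∈ =
      subst (λ t → hits π t ≡ hits π′ t) (sym (lookup-index t∈))
        (+-cancelˡ-≡ _ _ _ (trans (c i) (sym (c′ i))))
      where i = Any.index t∈

    pointsInto-agree : ∀ {T} → T ∈ₗ family →
      ∀ {a} → a ∈ₗ members A → pointsInto (π a) T ≡ pointsInto (π′ a) T
    pointsInto-agree {T} T∈ =
      design-detects (λ a → pointsInto (π a) T) (λ a → pointsInto (π′ a) T) j (members A) members-A-fits
        (λ i → cong₂ _+_ (hits-agree (left∈ i)) (sym (hits-agree (right∈ i))))
      where
      left∈ : ∀ i → (left (design j (members A) i) , T) ∈ₗ tests
      left∈ i = ∈-cartesianProduct⁺ (∈-++⁺ˡ (∈-map⁺ left (∈-tabulate⁺ i))) T∈
      right∈ : ∀ i → (right (design j (members A) i) , T) ∈ₗ tests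
      right∈ i = ∈-cartesianProduct⁺ (∈-++⁺ʳ (List.map left weighingsOfA) (∈-map⁺ right (∈-tabulate⁺ i))) T∈

  codes-agree : {c c′ : Fin (suc n)} → (∀ {T} → T ∈ₗ family → pointsInto c T ≡ pointsInto c′ T) →
    ∀ {y} → y ∈ₗ members B → c ≡ suc y → c′ ≡ suc y
  codes-agree {c′ = zero} agree {y} y∈ refl
    with trans (sym (dec-true (y ∈? members B) y∈)) (agree (here refl))
  ... | ()
  codes-agree {c′ = suc z} agree {y} y∈ refl =
    cong suc (sym (separators-separate K (members-unique B) members-B-fits y∈ z∈ λ i →
      does-≡⇒⇔ (y ∈? separator K (members B) i) (z ∈? separator K (members B) i)
               (agree (there (∈-tabulate⁺ i)))))
    where
    z∈ : z ∈ₗ members B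
    z∈ = Equivalence.to (does≡true⇔ (z ∈? members B))
           (trans (sym (agree (here refl))) (dec-true (y ∈? members B) y∈))

  module Correctness (cl : Clustering n) (iA : Independent cl A) (iB : Independent cl B) where
    open import Data.List.Membership.DecPropositional _≟_ using () renaming (_∈?_ to _∈ℕ?_)

    injectiveOn : ∀ {S : Subset n} → Independent cl S →
      ∀ {a b} → a ∈ₗ members S → b ∈ₗ members S → cl a ≡ cl b → a ≡ b
    injectiveOn {S} iS a∈ b∈ = iS _ _ (Equivalence.to (∈-members⇔ S) a∈) (Equivalence.to (∈-members⇔ S) b∈)

    labels-unique : ∀ {S : Subset n} → Independent cl S → ∀ {P} → P ⊆ members S → Unique (List.map cl P)
    labels-unique {S} iS P⊆ =
      Unique-resp-⊇ (⊆-map⁺ cl P⊆) (Unique-map-injectiveOn cl (injectiveOn iS) (members-unique S))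

    partner : Candidate
    partner a with any? (λ y → cl a ≟ cl y) (members B)
    ... | yes p = suc (proj₁ (find p))
    ... | no _ = zero

    partner-matches : ∀ a {y} → y ∈ₗ members B → partner a ≡ suc y ⇔ cl a ≡ cl y
    partner-matches a {y} y∈ with any? (λ y → cl a ≟ cl y) (members B)
    ... | yes p = let z , z∈ , a~z = find p in mk⇔
      (λ sz≡sy → subst (λ w → cl a ≡ cl w) (Fin.suc-injective sz≡sy) a~z)
      (λ a~y → cong suc (injectiveOn iB z∈ y∈ (trans (sym a~z) a~y)))
    ... | no ¬p = mk⇔ (λ ()) (λ a~y → ⊥-elim (¬p (lose y∈ a~y)))

    pointsInto-partner : ∀ {T} → T ⊆ members B → ∀ a → pointsInto (partner a) T ≡ meets cl T a
    pointsInto-partner {T} T⊆ a with any? (λ y → cl a ≟ cl y) (members B)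
    ... | yes p = let z , z∈ , a~z = find p in
      does-⇔ (mk⇔ (to a~z) (from z∈ a~z)) (z ∈? T) (cl a ∈ℕ? List.map cl T)
      where
      to : ∀ {z} → cl a ≡ cl z → z ∈ₗ T → cl a ∈ₗ List.map cl T
      to a~z z∈T = subst (_∈ₗ List.map cl T) (sym a~z) (∈-map⁺ cl z∈T)
      from : ∀ {z} → z ∈ₗ members B → cl a ≡ cl z → cl a ∈ₗ List.map cl T → z ∈ₗ T
      from z∈ a~z c∈ with ∈-map⁻ cl c∈
      ... | t , t∈ , a~t =
        subst (_∈ₗ T) (sym (injectiveOn iB z∈ (Any-resp-⊆ T⊆ t∈) (trans (sym a~z) a~t))) t∈
    ... | no ¬p = sym (dec-false (cl a ∈ℕ? List.map cl T) λ c∈ →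
      let t , t∈ , a~t = ∈-map⁻ cl c∈ in ¬p (lose (Any-resp-⊆ T⊆ t∈) a~t))

    answers : Vec ℕ q
    answers = map (count cl) queries

    count-test : ∀ {t} → t ∈ₗ tests → count cl (querySet t) + hits partner t ≡ size t
    count-test {P , T} t∈ =
      let P∈ , T∈ = ∈-cartesianProduct⁻ pans family t∈ in
      trans (cong (count cl (querySet (P , T)) +_) (weight-cong (pointsInto-partner (family-⊆ T∈)) P))
            (count-subsetOf-++ cl P T (labels-unique iA (pan-⊆ P∈)) (labels-unique iB (family-⊆ T∈)))

    lookup-answers : ∀ i → Vec.lookup answers i ≡ count cl (querySet (lookup tests i))
    lookup-answers i = trans (lookup-map i (count cl) queries) (cong (count cl) (lookup∘tabulate _ i))

    partner-consistent : Consistent answers partner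
    partner-consistent i =
      trans (cong (_+ hits partner (lookup tests i)) (lookup-answers i)) (count-test (∈-lookup {xs = tests} i))

    consistent-matches : ∀ {π} → Consistent answers π →
      ∀ {a y} → a ∈ₗ members A → y ∈ₗ members B → π a ≡ suc y ⇔ cl a ≡ cl y
    consistent-matches {π} c {a} a∈ y∈ =
      ⇔.trans (mk⇔ (codes-agree agree y∈) (codes-agree (λ T∈ → sym (agree T∈)) y∈)) (partner-matches a y∈)
      where
      agree : ∀ {T} → T ∈ₗ family → pointsInto (π a) T ≡ pointsInto (partner a) T
      agree T∈ = pointsInto-agree {answers} {π} {partner} c partner-consistent T∈ a∈

    decode-correct : ∀ {x y} → x ∈ A → y ∈ B → decode answers x y ≡ true ⇔ MatchEdge cl x y
    decode-correct {x} {y} x∈ y∈ with Fin.any? (λ k → consistent? answers (finToFun k))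
    ... | yes (k , c) = ⇔.trans (does≡true⇔ (finToFun k x Fin.≟ suc y))
      (consistent-matches {finToFun k} c (Equivalence.from (∈-members⇔ A) x∈) (Equivalence.from (∈-members⇔ B) y∈))
    ... | no ¬c = ⊥-elim (¬c (funToFin partner ,
      Consistent-resp-≗ {answers} {partner} (sym ∘ finToFun-funToFin partner) partner-consistent))

corollary5p4 :
  ∃[ c ] ((n : ℕ) (A B : Subset n) → 2 ≤ ∣ A ∣ → 2 ≤ ∣ B ∣ →
    ∃[ q ] ((q * ⌊log₂ ∣ A ∣ ⌋ ≤ c * ∣ A ∣ * ⌈log₂ ∣ B ∣ ⌉) ×
      Σ (Vec (Subset n) q) (λ queries →
        Σ (Vec ℕ q → Fin n → Fin n → Bool) (λ decode →
          (cl : Clustering n) → Independent cl A → Independent cl B →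
            (x y : Fin n) → x ∈ A → y ∈ B →
              (decode (map (count cl) queries) x y ≡ true) ⇔ MatchEdge cl x y))))
corollary5p4 = 32 , λ n A B 2≤∣A∣ 2≤∣B∣ → let open Scheme A B in
  q , q-bound 2≤∣A∣ 2≤∣B∣ , queries , decode , λ cl iA iB x y → Correctness.decode-correct cl iA iB {x} {y}
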